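{- Let $k\ge 2$ and $p=\frac{k-1}{k}$. There exists $\mu_0>0$ such that for all $0 < \mu < \mu_0$, with probability tending to one as $n \to \infty$, $A^{(k)}_n$ fails $\texttt{Disc}^{(k)}(\binom{[k]}{k-1}, \geq p, \mu)$.
   Context: For $k\ge2$, $A^{(k)}_n$ is the random $k$-graph on an $n$-element vertex set $V$ obtained by choosing independent uniform colors $f(T)\in\{0,\dots,k-1\}$ for all $T\in\binom{V}{k-1}$ and letting $E\in\binom{V}{k}$ be an edge iff $\sum_{T\subseteq E,|T|=k-1}f(T)\not\equiv0\pmod k$. $\binom{[k]}{k-1}$ is the family of all $(k-1)$-subsets of $[k]$. For $\mathcal{I}\subseteq 2^{[k]}$ and a $k$-graph $H$ on $n$ vertices, an $\mathcal{I}$-layout is a tuple $\Lambda=(\lambda_I)_{I\in\mathcal{I}}$ of $|I|$-uniform hypergraphs on $V(H)$; $K_k(\Lambda)$ is the set of ordered $k$-tuples of distinct vertices $(x_1,\dots,x_k)$ with $\{x_i:i\in I\}\in\lambda_I$ for all $I$; $H\cap K_k(\Lambda)$ is the set of those tuples whose underlying set is an edge of $H$. $H$ satisfies $\texttt{Disc}^{(k)}(\mathcal{I},\geq p,\mu)$ if $|H\cap K_k(\Lambda)|\ge p|K_k(\Lambda)|-\mu n^k$ for every $\mathcal{I}$-layout, and fails it otherwise.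
   Formalization: The parameter μ ranges only over the rationals, and the threshold μ₀ is taken in ℚ. -}

module Defs where

open import Data.Bool using (Bool; true; false; not; _∧_; if_then_else_)
open import Data.Nat using (ℕ; zero; suc; _^_; _∸_)
open import Data.Nat.Divisibility using (_∣?_)
open import Data.Fin using (Fin)
import Data.Fin as F
open import Data.Fin.Subset using (Subset; inside; outside; ⊥; ⁅_⁆; _∪_)
open import Data.Fin.Subset.Properties using (_⊆?_)
open import Data.List using (List; []; _∷_; [_]; _++_; map; concatMap; length; filter; allFin; foldr)
open import Data.Nat.ListAction using (sum)
open import Data.Bool.ListAction using (any; all)
import Data.List as L
open import Data.Vec using (Vec; lookup; toList)
import Data.Vec as V
open import Data.Integer using (+_)
open import Data.Rational using (ℚ; _/_; _<_; _*_; _-_)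
open import Data.Product using (∃)
open import Relation.Nullary.Decidable using (⌊_⌋)
open import Data.Bool.Properties using (T?)
open import Relation.Binary.PropositionalEquality using (_≡_)

ℕ→ℚ : ℕ → ℚ
ℕ→ℚ n = + n / 1

pOf : ℕ → ℚ
pOf zero    = ℕ→ℚ 0
pOf (suc j) = + j / suc j

subsetsOfSize : (n r : ℕ) → List (Subset n)
subsetsOfSize zero    zero    = [ V.[] ]
subsetsOfSize zero    (suc r) = []
subsetsOfSize (suc n) zero    = map (outside V.∷_) (subsetsOfSize n zero)
subsetsOfSize (suc n) (suc r) =
  map (outside V.∷_) (subsetsOfSize n (suc r)) ++ map (inside V.∷_) (subsetsOfSize n r)

Tsets : (k n : ℕ) → List (Subset n)
Tsets k n = subsetsOfSize n (k ∸ 1)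

m : (k n : ℕ) → ℕ
m k n = length (Tsets k n)

-- a colouring f : binom(V, k-1) → {0,…,k-1}; the i-th entry is the colour
-- of the i-th (k-1)-set in the enumeration Tsets k n
Colouring : (k n : ℕ) → Set
Colouring k n = Vec (Fin k) (m k n)

colourSum : ∀ {k n} → Colouring k n → Subset n → ℕ
colourSum {k} {n} c E =
  sum (map (λ i → F.toℕ (lookup c i))
           (filter (λ i → L.lookup (Tsets k n) i ⊆? E) (allFin (m k n))))

-- edge relation of A^(k)_n for the colouring c (queried on k-sets E)
isEdge : ∀ {k n} → Colouring k n → Subset n → Bool
isEdge {k} c E = not ⌊ k ∣? colourSum c E ⌋

tuples : (k n : ℕ) → List (Vec (Fin n) k)
tuples zero    n = [ V.[] ]
tuples (suc k) n = concatMap (λ v → map (V._∷ v) (allFin n)) (tuples k n)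

distinct : ∀ {k n} → Vec (Fin n) k → Bool
distinct V.[]       = true
distinct (x V.∷ xs) = not (any (λ y → ⌊ x F.≟ y ⌋) (toList xs)) ∧ distinct xs

imageExcept : ∀ {k n} → Vec (Fin n) k → Fin k → Subset n
imageExcept {k} v j =
  foldr (λ i S → (if ⌊ i F.≟ j ⌋ then ⊥ else ⁅ lookup v i ⁆) ∪ S) ⊥ (allFin k)

image : ∀ {k n} → Vec (Fin n) k → Subset n
image {k} v = foldr (λ i S → ⁅ lookup v i ⁆ ∪ S) ⊥ (allFin k)

-- A binom([k],k-1)-layout: the member indexed by j : Fin k is the
-- (k-1)-graph λ_{[k]\{j}}, given as a predicate on subsets of V
-- (only ever queried on (k-1)-sets).
Layout : (k n : ℕ) → Set
Layout k n = Fin k → Subset n → Bool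

inK : ∀ {k n} → Layout k n → Vec (Fin n) k → Bool
inK {k} Λ v = distinct v ∧ all (λ j → Λ j (imageExcept v j)) (allFin k)

Kcount : ∀ {k n} → Layout k n → ℕ
Kcount {k} {n} Λ = length (filter (λ v → T? (inK Λ v)) (tuples k n))

HKcount : ∀ {k n} → Colouring k n → Layout k n → ℕ
HKcount {k} {n} c Λ =
  length (filter (λ v → T? (inK Λ v ∧ isEdge c (image v))) (tuples k n))

FailsDisc : (k n : ℕ) → ℚ → ℚ → Colouring k n → Set
FailsDisc k n p μ c =
  ∃ λ (Λ : Layout k n) →
    ℕ→ℚ (HKcount c Λ) < p * ℕ→ℚ (Kcount Λ) - μ * ℕ→ℚ (n ^ k)

module Submission where

-- We prove more: for n ≥ R every colouring f fails it.
--
-- Given f and a colour a, let Λₐ be the layout all of whose members are the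
-- (k-1)-sets of colour a.  The vertex set E of a clique of Λₐ has all its k
-- (k-1)-subsets of colour a, so its colour sum is k·a ≡ 0 and E is not an
-- edge: |H ∩ K_k(Λₐ)| = 0.  Ramsey's theorem for (k-1)-sets with k colours
-- finds such a clique inside any R vertices, and a supersaturation count
-- (blocks of size n/R, transversals, an encoding bound) turns this into
-- |K_k(Λₐ)| ≥ n^k / D for some a.  With μ₀ = p / D this gives
-- 0 < p|K_k(Λₐ)| - μ n^k.

module ListCounting where

  open import Data.Nat using (ℕ; zero; suc; _+_; _*_; _^_; _∸_; _≤_)
  open import Data.Nat.Properties
  open import Data.Fin using (Fin; zero; suc)
  import Data.Fin.Properties as Fin
  open import Data.List using (List; []; _∷_; _++_; length; map; filter; concatMap; allFin; lookup; take; tabulate; cartesianProductWith; cartesianProduct)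
  import Data.List.Properties as List
  open import Data.List.Membership.Propositional using (_∈_)
  open import Data.List.Membership.Propositional.Properties using (∈-lookup; ∈-map⁺; ∈-cartesianProductWith⁺; ∈-cartesianProduct⁺)
  open import Data.List.Relation.Unary.Any using (here; there; index)
  open import Data.List.Relation.Unary.Any.Properties using (lookup-index)
  import Data.List.Relation.Unary.All as All
  open import Data.List.Relation.Unary.AllPairs using ([]; _∷_)
  open import Data.List.Relation.Unary.Unique.Propositional using (Unique)
  import Data.List.Relation.Unary.Unique.Propositional.Properties as Unique
  open import Data.List.Relation.Binary.Sublist.Propositional using ([]; _∷ʳ_; _∷_) renaming (_⊆_ to _⊑_)
  open import Data.List.Relation.Binary.Sublist.Propositional.Properties using (Any-resp-⊆; take-⊆)
  open import Data.Vec using (Vec)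
  import Data.Vec as Vec
  import Data.Vec.Properties as Vec
  open import Data.Product using (∃; _×_; _,_)
  open import Relation.Nullary using (yes; no; does)
  open import Relation.Unary using (Pred; Decidable)
  open import Level using (0ℓ)
  open import Relation.Nullary.Decidable using (⌊_⌋)
  open import Relation.Binary.PropositionalEquality
  open import Data.Empty using (⊥-elim)
  open import Data.Bool using (Bool; true; false; if_then_else_)
  import Data.Nat.ListAction as ListSum
  open import Algebra.Properties.CommutativeMonoid.Sum +-0-commutativeMonoid using (sum; ∑-distrib-+; sum-cong-≗; sum-replicate-zero)

  Unique⇒lookup-injective : ∀ {A : Set} {xs : List A} → Unique xs →
    ∀ {i j} → lookup xs i ≡ lookup xs j → i ≡ j
  Unique⇒lookup-injective (_ ∷ _) {zero} {zero} _ = refl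
  Unique⇒lookup-injective (x∉ ∷ _) {zero} {suc j} e = ⊥-elim (All.lookup x∉ (∈-lookup j) e)
  Unique⇒lookup-injective (x∉ ∷ _) {suc i} {zero} e = ⊥-elim (All.lookup x∉ (∈-lookup i) (sym e))
  Unique⇒lookup-injective (_ ∷ u) {suc i} {suc j} e = cong suc (Unique⇒lookup-injective u e)

  Unique⇒length-≤ : ∀ {A : Set} {xs ys : List A} → Unique xs →
    (∀ {x} → x ∈ xs → x ∈ ys) → length xs ≤ length ys
  Unique⇒length-≤ {xs = xs} {ys} u xs⊆ys = Fin.injective⇒≤ position-injective
    where
      position : Fin (length xs) → Fin (length ys)
      position i = index (xs⊆ys (∈-lookup i))
      entry : ∀ i → lookup xs i ≡ lookup ys (position i)
      entry i = lookup-index (xs⊆ys (∈-lookup i))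
      position-injective : ∀ {i j} → position i ≡ position j → i ≡ j
      position-injective {i} {j} e =
        Unique⇒lookup-injective u (trans (entry i) (trans (cong (lookup ys) e) (sym (entry j))))

  Unique-⊑ : ∀ {A : Set} {xs ys : List A} → xs ⊑ ys → Unique ys → Unique xs
  Unique-⊑ [] u = []
  Unique-⊑ (_ ∷ʳ p) (_ ∷ u) = Unique-⊑ p u
  Unique-⊑ (refl ∷ p) (y∉ ∷ u) = All.tabulate (λ m → All.lookup y∉ (Any-resp-⊆ p m)) ∷ Unique-⊑ p u

  sublist-of-length : ∀ {A : Set} t (xs : List A) → t ≤ length xs →
    ∃ λ ys → ys ⊑ xs × length ys ≡ t
  sublist-of-length t xs t≤ = take t xs , take-⊆ t xs , trans (List.length-take t xs) (m≤n⇒m⊓n≡m t≤)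

  sum≤size*max : ∀ q (f : Fin (suc q) → ℕ) → ∃ λ c → sum f ≤ suc q * f c
  sum≤size*max zero f = zero , ≤-refl
  sum≤size*max (suc q) f with sum≤size*max q (λ i → f (suc i))
  ... | c , sum≤ with f (suc c) ≤? f zero
  ...   | yes fc≤f0 = zero , +-monoʳ-≤ (f zero) (≤-trans sum≤ (*-monoʳ-≤ (suc q) fc≤f0))
  ...   | no fc≰f0 = suc c , +-mono-≤ (<⇒≤ (≰⇒> fc≰f0)) sum≤

  indicator : ∀ {q} → Fin q → Fin q → ℕ
  indicator d c = if ⌊ d Fin.≟ c ⌋ then 1 else 0

  sum-indicator : ∀ {q} (d : Fin q) → sum (indicator d) ≡ 1
  sum-indicator {suc q} zero = cong suc (sum-replicate-zero q)
  sum-indicator {suc q} (suc d) = trans (sum-cong-≗ {q} shift) (sum-indicator d)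
    where shift : ∀ i → indicator (suc d) (suc i) ≡ indicator d i
          shift i with d Fin.≟ i
          ... | yes _ = refl
          ... | no _ = refl

  module _ {B : Set} {q : ℕ} (colour : B → Fin q) where

    class : Fin q → List B → List B
    class c = filter (λ x → colour x Fin.≟ c)

    length-class-∷ : ∀ x C c → length (class c (x ∷ C)) ≡ indicator (colour x) c + length (class c C)
    length-class-∷ x C c with colour x Fin.≟ c
    ... | yes _ = refl
    ... | no _ = refl

    length≡∑class : ∀ C → length C ≡ sum (λ c → length (class c C))
    length≡∑class [] = sym (sum-replicate-zero q)
    length≡∑class (x ∷ C) = begin
      1 + length C
        ≡⟨ cong₂ _+_ (sym (sum-indicator (colour x))) (length≡∑class C) ⟩
      sum (indicator (colour x)) + sum (λ c → length (class c C))
        ≡⟨ sym (∑-distrib-+ (indicator (colour x)) (λ c → length (class c C))) ⟩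
      sum (λ c → indicator (colour x) c + length (class c C))
        ≡⟨ sum-cong-≗ {q} (λ c → sym (length-class-∷ x C c)) ⟩
      sum (λ c → length (class c (x ∷ C))) ∎
      where open ≡-Reasoning

  pigeonhole : ∀ {B : Set} {q} (colour : B → Fin (suc q)) (C : List B) →
    ∃ λ c → length C ≤ suc q * length (class colour c C)
  pigeonhole {q = q} colour C with sum≤size*max q (λ c → length (class colour c C))
  ... | c , ∑≤ = c , ≤-trans (≤-reflexive (length≡∑class colour C)) ∑≤

  length-cartesianProductWith : ∀ {A B C : Set} (f : A → B → C) xs ys →
    length (cartesianProductWith f xs ys) ≡ length xs * length ys
  length-cartesianProductWith f [] ys = refl
  length-cartesianProductWith f (x ∷ xs) ys =
    trans (List.length-++ (map (f x) ys)) (cong₂ _+_ (List.length-map (f x) ys) (length-cartesianProductWith f xs ys))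

  allVecs : ∀ {A : Set} → List A → (m : ℕ) → List (Vec A m)
  allVecs xs zero = Vec.[] ∷ []
  allVecs xs (suc m) = cartesianProductWith Vec._∷_ xs (allVecs xs m)

  length-allVecs : ∀ {A : Set} (xs : List A) m → length (allVecs xs m) ≡ length xs ^ m
  length-allVecs xs zero = refl
  length-allVecs xs (suc m) =
    trans (length-cartesianProductWith Vec._∷_ xs (allVecs xs m)) (cong (length xs *_) (length-allVecs xs m))

  Unique-allVecs : ∀ {A : Set} {xs : List A} → Unique xs → ∀ m → Unique (allVecs xs m)
  Unique-allVecs u zero = All.[] ∷ []
  Unique-allVecs u (suc m) = Unique.cartesianProductWith⁺ Vec._∷_ Vec.∷-injective u (Unique-allVecs u m)

  ∈-allVecs : ∀ {A : Set} {xs : List A} → (∀ x → x ∈ xs) → ∀ {m} (v : Vec A m) → v ∈ allVecs xs m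
  ∈-allVecs every Vec.[] = here refl
  ∈-allVecs every (x Vec.∷ v) = ∈-cartesianProductWith⁺ Vec._∷_ (every x) (∈-allVecs every v)

  ∈-words : ∀ {A : Set} {xs : List A} → (∀ x → x ∈ xs) → ∀ {m} (w : List A) → length w ≡ m →
    w ∈ map Vec.toList (allVecs xs m)
  ∈-words {xs = xs} every w refl = subst (_∈ map Vec.toList (allVecs xs (length w))) (Vec.toList∘fromList w)
    (∈-map⁺ Vec.toList (∈-allVecs every (Vec.fromList w)))

  -- A sublist X ⊑ w is recorded by the mask of kept positions; the mask,
  -- X and the complementary sublist together determine w.
  module _ {A : Set} where

    mask : {X w : List A} → X ⊑ w → List Bool
    mask [] = []
    mask (_ ∷ʳ p) = false ∷ mask p
    mask (_ ∷ p) = true ∷ mask p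

    complement : {X w : List A} → X ⊑ w → List A
    complement [] = []
    complement (y ∷ʳ p) = y ∷ complement p
    complement (_ ∷ p) = complement p

    interleave : List Bool → List A → List A → List A
    interleave (true ∷ bs) (x ∷ xs) ys = x ∷ interleave bs xs ys
    interleave (false ∷ bs) xs (y ∷ ys) = y ∷ interleave bs xs ys
    interleave _ _ _ = []

    interleave-mask : {X w : List A} (p : X ⊑ w) → interleave (mask p) X (complement p) ≡ w
    interleave-mask [] = refl
    interleave-mask (y ∷ʳ p) = cong (y ∷_) (interleave-mask p)
    interleave-mask (refl ∷ p) = cong (_ ∷_) (interleave-mask p)

    length-mask : {X w : List A} (p : X ⊑ w) → length (mask p) ≡ length w
    length-mask [] = refl
    length-mask (_ ∷ʳ p) = cong suc (length-mask p)
    length-mask (_ ∷ p) = cong suc (length-mask p)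

    length-complement : {X w : List A} (p : X ⊑ w) → length (complement p) + length X ≡ length w
    length-complement [] = refl
    length-complement (_ ∷ʳ p) = cong suc (length-complement p)
    length-complement {X = _ ∷ X} (_ ∷ p) = trans (+-suc (length (complement p)) (length X)) (cong suc (length-complement p))

  -- Encoding bound: if each word of a duplicate-free family of words of
  -- length R over a complete alphabet As contains, as a sublist, some member
  -- of U of length k, then the family has at most 2^R · |U| · |As|^(R∸k)
  -- members, since (mask, sublist, complement) determines the word.
  encoding-bound : ∀ {A : Set} (As : List A) → (∀ x → x ∈ As) → ∀ R k (U ws : List (List A)) → Unique ws →
    (∀ {w} → w ∈ ws → length w ≡ R × ∃ λ X → X ⊑ w × length X ≡ k × X ∈ U) →
    length ws ≤ 2 ^ R * (length U * length As ^ (R ∸ k))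
  encoding-bound {A} As every R k U ws u encodable = begin
    length ws ≤⟨ Unique⇒length-≤ u ws⊆codes ⟩
    length codes ≡⟨ length-cartesianProductWith decode masks (cartesianProduct U rests) ⟩
    length masks * length (cartesianProduct U rests)
      ≡⟨ cong₂ _*_ (words-count (true ∷ false ∷ []) R) (trans (length-cartesianProductWith _,_ U rests) (cong (length U *_) (words-count As (R ∸ k)))) ⟩
    2 ^ R * (length U * length As ^ (R ∸ k)) ∎
    where
      open ≤-Reasoning
      words : ∀ {B : Set} → List B → ℕ → List (List B)
      words Bs m = map Vec.toList (allVecs Bs m)
      words-count : ∀ {B : Set} (Bs : List B) m → length (words Bs m) ≡ length Bs ^ m
      words-count Bs m = trans (List.length-map Vec.toList (allVecs Bs m)) (length-allVecs Bs m)
      masks = words (true ∷ false ∷ []) R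
      rests = words As (R ∸ k)
      decode : List Bool → List A × List A → List A
      decode bs (X , ys) = interleave bs X ys
      codes = cartesianProductWith decode masks (cartesianProduct U rests)
      bool : ∀ b → b ∈ true ∷ false ∷ []
      bool true = here refl
      bool false = there (here refl)
      ws⊆codes : ∀ {w} → w ∈ ws → w ∈ codes
      ws⊆codes w∈ with encodable w∈
      ... | |w| , X , p , |X| , X∈U = subst (_∈ codes) (interleave-mask p)
        (∈-cartesianProductWith⁺ decode (∈-words bool (mask p) (trans (length-mask p) |w|))
          (∈-cartesianProduct⁺ X∈U (∈-words every (complement p) |complement|)))
        where
          |complement| : length (complement p) ≡ R ∸ k
          |complement| = trans (sym (m+n∸n≡m (length (complement p)) k))
            (cong (_∸ k) (trans (cong (length (complement p) +_) (sym |X|)) (trans (length-complement p) |w|)))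

  module _ {A B : Set} {P : Pred B 0ℓ} {Q : Pred A 0ℓ} (P? : Decidable P) (Q? : Decidable Q) where

    length-filter-map : (g : A → B) → (∀ x → does (P? (g x)) ≡ does (Q? x)) →
      ∀ xs → length (filter P? (map g xs)) ≡ length (filter Q? xs)
    length-filter-map g same [] = refl
    length-filter-map g same (x ∷ xs) with P? (g x) | Q? x | same x
    ... | yes _ | yes _ | _ = cong suc (length-filter-map g same xs)
    ... | no _ | no _ | _ = length-filter-map g same xs

  length-filter-++ : ∀ {A : Set} {P : Pred A 0ℓ} (P? : Decidable P) xs ys →
    length (filter P? (xs ++ ys)) ≡ length (filter P? xs) + length (filter P? ys)
  length-filter-++ P? xs ys = trans (cong length (List.filter-++ P? xs ys)) (List.length-++ (filter P? xs))

  length-filter-positions : ∀ {A : Set} {P : Pred A 0ℓ} (P? : Decidable P) (xs : List A) →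
    length (filter (λ i → P? (lookup xs i)) (allFin (length xs))) ≡ length (filter P? xs)
  length-filter-positions P? xs = begin
    length (filter (λ i → P? (lookup xs i)) (allFin (length xs)))
      ≡⟨ length-filter-map P? (λ i → P? (lookup xs i)) (lookup xs) (λ _ → refl) (allFin (length xs)) ⟨
    length (filter P? (map (lookup xs) (allFin (length xs))))
      ≡⟨ cong (λ ys → length (filter P? ys)) (trans (List.map-tabulate (λ i → i) (lookup xs)) (List.tabulate-lookup xs)) ⟩
    length (filter P? xs) ∎
    where open ≡-Reasoning

  sum-map-const : ∀ {A : Set} (f : A → ℕ) c xs → All.All (λ x → f x ≡ c) xs → ListSum.sum (map f xs) ≡ length xs * c
  sum-map-const f c [] All.[] = refl
  sum-map-const f c (x ∷ xs) (fx≡c All.∷ fs) = cong₂ _+_ fx≡c (sum-map-const f c xs fs)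

  length-concatMap-tabulate : ∀ {B : Set} {q N} (f : Fin N → List B) (g : Fin q → Fin N) →
    length (concatMap f (tabulate g)) ≡ sum (λ i → length (f (g i)))
  length-concatMap-tabulate {q = zero} f g = refl
  length-concatMap-tabulate {q = suc q} f g =
    trans (List.length-++ (f (g zero))) (cong (length (f (g zero)) +_) (length-concatMap-tabulate f (λ i → g (suc i))))

module Ramsey where

  open import Data.Nat using (ℕ; zero; suc; _*_; _≤_; s≤s)
  open import Data.Nat.Properties using (≤-trans; ≤-reflexive; *-cancelˡ-≤; suc-injective)
  open import Data.Fin using (Fin)
  open import Data.List using (List; []; _∷_; length; map)
  open import Data.List.Properties using (length-map)
  open import Data.List.Relation.Unary.All using (All; []; _∷_)
  open import Data.List.Relation.Unary.All.Properties using (all-filter)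
  open import Data.List.Relation.Binary.Sublist.Propositional using ([]; _∷ʳ_; _∷_; minimum; ⊆-trans) renaming (_⊆_ to _⊑_)
  open import Data.List.Relation.Binary.Sublist.Propositional.Properties using (map⁺; All-resp-⊆; filter-⊆)
  open import Data.Product using (∃; _×_; _,_; proj₁; proj₂)
  open import Data.Unit using (⊤; tt)
  open import Relation.Binary.PropositionalEquality using (_≡_; refl; sym; trans; cong)
  open ListCounting using (sublist-of-length; class; pigeonhole)

  Monochromatic : ∀ {A : Set} {q} (r : ℕ) (χ : List A → Fin q) (c : Fin q) (X : List A) → Set
  Monochromatic r χ c X = ∀ s → s ⊑ X → length s ≡ r → χ s ≡ c

  IsRamseyNumber : (r q t R : ℕ) → Set₁
  IsRamseyNumber r q t R = ∀ {A : Set} (S : List A) → R ≤ length S → (χ : List A → Fin q) →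
    ∃ λ X → X ⊑ S × length X ≡ t × ∃ λ c → Monochromatic r χ c X

  -- Colouring 0-element sublists is colouring the single list [].
  ramsey-zero : ∀ q t → IsRamseyNumber 0 q t t
  ramsey-zero q t S t≤ χ with sublist-of-length t S t≤
  ... | X , X⊑S , |X| = X , X⊑S , |X| , χ [] , λ { [] _ _ → refl }

  -- The Erdős–Rado step from r to r+1: greedily build a chain a₁, a₂, …, where
  -- aᵢ together with any r-sublist of the later elements has a colour cᵢ
  -- depending only on i; then pigeonhole on the cᵢ.
  module Step {q : ℕ} (r : ℕ) (Rr : ℕ → ℕ) (ramsey-r : ∀ t → IsRamseyNumber r (suc q) t (Rr t)) where

    module _ {A : Set} (χ : List A → Fin (suc q)) where

      Chain : List (A × Fin (suc q)) → Set
      Chain [] = ⊤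
      Chain ((a , c) ∷ C) = (∀ s → s ⊑ map proj₁ C → length s ≡ r → χ (a ∷ s) ≡ c) × Chain C

      Chain-⊑ : ∀ {D C} → D ⊑ C → Chain C → Chain D
      Chain-⊑ [] _ = tt
      Chain-⊑ (_ ∷ʳ p) (_ , ch) = Chain-⊑ p ch
      Chain-⊑ (refl ∷ p) (sees , ch) = (λ s s⊑ |s| → sees s (⊆-trans s⊑ (map⁺ proj₁ p)) |s|) , Chain-⊑ p ch

      Chain⇒Monochromatic : ∀ c D → Chain D → All (λ e → proj₂ e ≡ c) D → Monochromatic (suc r) χ c (map proj₁ D)
      Chain⇒Monochromatic c [] _ _ [] [] ()
      Chain⇒Monochromatic c ((a , c′) ∷ D) (_ , ch) (_ ∷ cs) s (_ ∷ʳ p) |s| = Chain⇒Monochromatic c D ch cs s p |s|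
      Chain⇒Monochromatic c ((a , c′) ∷ D) (sees , _) (c′≡c ∷ _) (_ ∷ s) (refl ∷ p) |s| = trans (sees s p (suc-injective |s|)) c′≡c

    -- Length of a list guaranteeing a chain of length j.
    chainBound : ℕ → ℕ
    chainBound zero = 0
    chainBound (suc j) = suc (Rr (chainBound j))

    chain : ∀ {A : Set} (χ : List A → Fin (suc q)) j (S : List A) → chainBound j ≤ length S →
      ∃ λ C → map proj₁ C ⊑ S × length C ≡ j × Chain χ C
    chain χ zero S _ = [] , minimum S , refl , tt
    chain χ (suc j) (a ∷ S) (s≤s bound) with ramsey-r (chainBound j) S bound (λ s → χ (a ∷ s))
    ... | X , X⊑S , |X| , c , mono with chain χ j X (≤-reflexive (sym |X|))
    ...   | C , C⊑X , |C| , ch = (a , c) ∷ C , refl ∷ ⊆-trans C⊑X X⊑S , cong suc |C| ,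
            ((λ s s⊑ |s| → mono s (⊆-trans s⊑ C⊑X) |s|) , ch)

    ramsey-suc : ∀ t → IsRamseyNumber (suc r) (suc q) t (chainBound (suc q * t))
    ramsey-suc t S bound χ with chain χ (suc q * t) S bound
    ... | C , C⊑S , |C| , ch with pigeonhole proj₂ C
    ...   | c , share with sublist-of-length t (class proj₂ c C) (*-cancelˡ-≤ (suc q) (≤-trans (≤-reflexive (sym |C|)) share))
    ...     | D , D⊑class , |D| =
              map proj₁ D , ⊆-trans (map⁺ proj₁ D⊑C) C⊑S , trans (length-map proj₁ D) |D| , c ,
              Chain⇒Monochromatic χ c D (Chain-⊑ χ D⊑C ch) (All-resp-⊆ D⊑class (all-filter _ C))
      where D⊑C = ⊆-trans D⊑class (filter-⊆ _ C)

  -- Ramsey's theorem for lists: Ramsey numbers exist for every r, q and t.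
  -- (Opaque: the numbers grow like towers and must never be unfolded.)
  opaque
    ramsey : ∀ r q t → ∃ λ R → IsRamseyNumber r (suc q) t R
    ramsey zero q t = t , ramsey-zero (suc q) t
    ramsey (suc r) q t = Step.chainBound r Rr IH (suc q * t) , Step.ramsey-suc r Rr IH t
      where
        Rr : ℕ → ℕ
        Rr t = proj₁ (ramsey r q t)
        IH : ∀ t → IsRamseyNumber r (suc q) t (Rr t)
        IH t = proj₂ (ramsey r q t)

module VertexSets where

  open import Defs
  open import Data.Nat using (zero; suc; _+_; _≤_; z≤n; s≤s)
  open import Data.Nat.Properties using (≤-refl; ≤-trans; ≤-reflexive; ≤-antisym; <⇒≱; +-comm; +-identityʳ; module ≤-Reasoning)
  open import Data.Nat.Combinatorics using (_C_; nCk+nC[k+1]≡[n+1]C[k+1])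
  open import Data.Bool using (not; if_then_else_; T)
  open import Data.Fin using (Fin; zero; suc; punchIn; punchOut)
  import Data.Fin as Fin
  import Data.Fin.Properties as Fin
  open import Data.Fin.Subset using (Subset; inside; outside; ⁅_⁆; _∪_; ∣_∣; _⊆_) renaming (_∈_ to _∈ₛ_; _∉_ to _∉ₛ_; ⊥ to ∅)
  open import Data.Fin.Subset.Properties using (_⊆?_; _∈?_; x∈⁅x⁆; x∈⁅y⁆⇒x≡y; x∈p∪q⁻; x∈p∪q⁺; ∉⊥; ⊆-antisym; p⊆q⇒∣p∣≤∣q∣; p⊂q⇒∣p∣<∣q∣; q⊆p∪q; ∪-identityˡ; ∣p∣≤∣x∷p∣; ∣⊥∣≡0)
  open import Data.List using (List; []; _∷_; _++_; length; map; filter; foldr; allFin; tabulate)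
  import Data.List.Properties as List
  open import Data.List.Membership.Propositional using (_∈_)
  open import Data.List.Membership.Propositional.Properties using (∈-map⁻; ∈-allFin; ∈-tabulate⁺; ∈-tabulate⁻)
  open import Data.List.Relation.Unary.Any using (here; there)
  open import Data.List.Relation.Unary.All using (All; []; _∷_)
  import Data.List.Relation.Unary.All as All
  import Data.List.Relation.Unary.All.Properties as All
  open import Data.List.Relation.Unary.AllPairs using ([]; _∷_)
  open import Data.List.Relation.Unary.Unique.Propositional using (Unique)
  import Data.List.Relation.Unary.Unique.Propositional.Properties as Unique
  open import Data.Vec using (Vec; lookup; toList)
  import Data.Vec as Vec
  import Data.Vec.Properties as Vec
  open import Data.Product using (∃; _×_; _,_; proj₁; proj₂)
  open import Data.Sum using (inj₁; inj₂)
  open import Relation.Nullary using (¬_; yes; no; does)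
  open import Relation.Nullary.Decidable using (⌊_⌋)
  open import Relation.Binary.PropositionalEquality
  open import Data.Empty using (⊥; ⊥-elim)
  open import Data.Bool.ListAction using (any)
  open import Data.Bool.Properties using (T-∧)
  open import Function.Bundles using (Equivalence)
  open import Function using (_∘_)
  open import Data.List.Relation.Binary.Sublist.Propositional using (_∷ʳ_; _∷_; ⊆-reflexive) renaming (_⊆_ to _⊑_)
  open ListCounting using (length-filter-map; length-filter-++)

  -- Unions of families of subsets, indexed by a list; `image`, `imageExcept`
  -- and the vertex set of a list are all of this form.
  ⋃ : ∀ {I : Set} {n} → (I → Subset n) → List I → Subset n
  ⋃ h L = foldr (λ i S → h i ∪ S) ∅ L

  ∈-⋃⁻ : ∀ {I : Set} {n} (h : I → Subset n) {x} L → x ∈ₛ ⋃ h L → ∃ λ i → i ∈ L × x ∈ₛ h i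
  ∈-⋃⁻ h [] x∈ = ⊥-elim (∉⊥ x∈)
  ∈-⋃⁻ h (i ∷ L) x∈ with x∈p∪q⁻ (h i) (⋃ h L) x∈
  ... | inj₁ x∈hi = i , here refl , x∈hi
  ... | inj₂ x∈⋃ with ∈-⋃⁻ h L x∈⋃
  ...   | j , j∈L , x∈hj = j , there j∈L , x∈hj

  ∈-⋃⁺ : ∀ {I : Set} {n} (h : I → Subset n) {x i} L → i ∈ L → x ∈ₛ h i → x ∈ₛ ⋃ h L
  ∈-⋃⁺ h (_ ∷ L) (here refl) x∈ = x∈p∪q⁺ (inj₁ x∈)
  ∈-⋃⁺ h (_ ∷ L) (there i∈L) x∈ = x∈p∪q⁺ (inj₂ (∈-⋃⁺ h L i∈L x∈))

  setOf : ∀ {n} → List (Fin n) → Subset n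
  setOf = ⋃ ⁅_⁆

  ∈-setOf⁻ : ∀ {n} {x : Fin n} xs → x ∈ₛ setOf xs → x ∈ xs
  ∈-setOf⁻ xs x∈ with ∈-⋃⁻ ⁅_⁆ xs x∈
  ... | y , y∈ , x∈⁅y⁆ = subst (_∈ xs) (sym (x∈⁅y⁆⇒x≡y y x∈⁅y⁆)) y∈

  ∈-setOf⁺ : ∀ {n} {x : Fin n} xs → x ∈ xs → x ∈ₛ setOf xs
  ∈-setOf⁺ xs x∈ = ∈-⋃⁺ ⁅_⁆ xs x∈ (x∈⁅x⁆ _)

  ∣⁅x⁆∪p∣≤1+∣p∣ : ∀ {n} (x : Fin n) p → ∣ ⁅ x ⁆ ∪ p ∣ ≤ suc ∣ p ∣
  ∣⁅x⁆∪p∣≤1+∣p∣ zero (b Vec.∷ p) rewrite ∪-identityˡ p = s≤s (∣p∣≤∣x∷p∣ b p)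
  ∣⁅x⁆∪p∣≤1+∣p∣ (suc x) (outside Vec.∷ p) = ∣⁅x⁆∪p∣≤1+∣p∣ x p
  ∣⁅x⁆∪p∣≤1+∣p∣ (suc x) (inside Vec.∷ p) = s≤s (∣⁅x⁆∪p∣≤1+∣p∣ x p)

  1+∣p∣≤∣⁅x⁆∪p∣ : ∀ {n} (x : Fin n) p → x ∉ₛ p → suc ∣ p ∣ ≤ ∣ ⁅ x ⁆ ∪ p ∣
  1+∣p∣≤∣⁅x⁆∪p∣ x p x∉p = p⊂q⇒∣p∣<∣q∣ (q⊆p∪q ⁅ x ⁆ p , x , x∈p∪q⁺ (inj₁ (x∈⁅x⁆ x)) , x∉p)

  ∣setOf∣≤length : ∀ {n} (xs : List (Fin n)) → ∣ setOf xs ∣ ≤ length xs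
  ∣setOf∣≤length {n} [] = ≤-reflexive (∣⊥∣≡0 n)
  ∣setOf∣≤length (x ∷ xs) = ≤-trans (∣⁅x⁆∪p∣≤1+∣p∣ x (setOf xs)) (s≤s (∣setOf∣≤length xs))

  Unique⇒∣setOf∣≡length : ∀ {n} {xs : List (Fin n)} → Unique xs → ∣ setOf xs ∣ ≡ length xs
  Unique⇒∣setOf∣≡length {xs = xs} u = ≤-antisym (∣setOf∣≤length xs) (length≤ u)
    where
      length≤ : ∀ {xs} → Unique xs → length xs ≤ ∣ setOf xs ∣
      length≤ [] = z≤n
      length≤ {x ∷ xs} (x∉ ∷ u) = ≤-trans (s≤s (length≤ u))
        (1+∣p∣≤∣⁅x⁆∪p∣ x (setOf xs) (λ x∈ → All.lookup x∉ (∈-setOf⁻ xs x∈) refl))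

  -- The enumeration `subsetsOfSize n r` lists each r-subset of Fin n once,
  -- and a set E contains exactly ∣E∣ C r of them (Pascal's rule).
  size-subsetsOfSize : ∀ n r → All (λ T → ∣ T ∣ ≡ r) (subsetsOfSize n r)
  size-subsetsOfSize zero zero = refl ∷ []
  size-subsetsOfSize zero (suc r) = []
  size-subsetsOfSize (suc n) zero = All.map⁺ (size-subsetsOfSize n zero)
  size-subsetsOfSize (suc n) (suc r) =
    All.++⁺ (All.map⁺ (size-subsetsOfSize n (suc r))) (All.map⁺ (All.map (cong suc) (size-subsetsOfSize n r)))

  Unique-subsetsOfSize : ∀ n r → Unique (subsetsOfSize n r)
  Unique-subsetsOfSize zero zero = All.[] ∷ []
  Unique-subsetsOfSize zero (suc r) = []
  Unique-subsetsOfSize (suc n) zero = Unique.map⁺ (λ e → proj₂ (Vec.∷-injective e)) (Unique-subsetsOfSize n zero)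
  Unique-subsetsOfSize (suc n) (suc r) =
    Unique.++⁺ (Unique.map⁺ (λ e → proj₂ (Vec.∷-injective e)) (Unique-subsetsOfSize n (suc r)))
               (Unique.map⁺ (λ e → proj₂ (Vec.∷-injective e)) (Unique-subsetsOfSize n r))
               disjoint
    where
      disjoint : ∀ {T} → ¬ (T ∈ map (outside Vec.∷_) (subsetsOfSize n (suc r)) × T ∈ map (inside Vec.∷_) (subsetsOfSize n r))
      disjoint (T∈out , T∈in) with ∈-map⁻ _ T∈out | ∈-map⁻ _ T∈in
      ... | _ , _ , refl | _ , _ , ()

  private
    count-prefix : ∀ {n} b b′ (E : Subset n) → (∀ S → does ((b Vec.∷ S) ⊆? (b′ Vec.∷ E)) ≡ does (S ⊆? E)) →
      ∀ Ts → length (filter (_⊆? (b′ Vec.∷ E)) (map (b Vec.∷_) Ts)) ≡ length (filter (_⊆? E) Ts)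
    count-prefix b b′ E same = length-filter-map (_⊆? (b′ Vec.∷ E)) (_⊆? E) (b Vec.∷_) same

    count-inside-outside : ∀ {n} (E : Subset n) Ts → length (filter (_⊆? (outside Vec.∷ E)) (map (inside Vec.∷_) Ts)) ≡ 0
    count-inside-outside E Ts = cong length (List.filter-none (_⊆? (outside Vec.∷ E)) {map (inside Vec.∷_) Ts} 
      (All.map⁺ (All.tabulate (λ _ sub → absurd (sub Vec.here)))))
      where absurd : ∀ {n} {E : Subset n} → zero ∈ₛ (outside Vec.∷ E) → ⊥
            absurd ()

  count-⊆-subsetsOfSize : ∀ n r (E : Subset n) → length (filter (_⊆? E) (subsetsOfSize n r)) ≡ ∣ E ∣ C r
  count-⊆-subsetsOfSize zero zero Vec.[] = refl
  count-⊆-subsetsOfSize zero (suc r) Vec.[] = refl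
  count-⊆-subsetsOfSize (suc n) zero (b Vec.∷ E) =
    trans (count-prefix outside b E (λ _ → refl) (subsetsOfSize n zero)) (count-⊆-subsetsOfSize n zero E)
  count-⊆-subsetsOfSize (suc n) (suc r) (outside Vec.∷ E) = begin
    length (filter (_⊆? (outside Vec.∷ E)) (outs ++ ins))
      ≡⟨ length-filter-++ (_⊆? (outside Vec.∷ E)) outs ins ⟩
    length (filter (_⊆? (outside Vec.∷ E)) outs) + length (filter (_⊆? (outside Vec.∷ E)) ins)
      ≡⟨ cong₂ _+_ (count-prefix outside outside E (λ _ → refl) (subsetsOfSize n (suc r))) (count-inside-outside E (subsetsOfSize n r)) ⟩
    length (filter (_⊆? E) (subsetsOfSize n (suc r))) + 0
      ≡⟨ +-identityʳ _ ⟩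
    length (filter (_⊆? E) (subsetsOfSize n (suc r)))
      ≡⟨ count-⊆-subsetsOfSize n (suc r) E ⟩
    ∣ E ∣ C suc r ∎
    where
      open ≡-Reasoning
      outs = map (outside Vec.∷_) (subsetsOfSize n (suc r))
      ins = map (inside Vec.∷_) (subsetsOfSize n r)
  count-⊆-subsetsOfSize (suc n) (suc r) (inside Vec.∷ E) = begin
    length (filter (_⊆? (inside Vec.∷ E)) (outs ++ ins))
      ≡⟨ length-filter-++ (_⊆? (inside Vec.∷ E)) outs ins ⟩
    length (filter (_⊆? (inside Vec.∷ E)) outs) + length (filter (_⊆? (inside Vec.∷ E)) ins)
      ≡⟨ cong₂ _+_ (count-prefix outside inside E (λ _ → refl) (subsetsOfSize n (suc r))) (count-prefix inside inside E (λ _ → refl) (subsetsOfSize n r)) ⟩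
    length (filter (_⊆? E) (subsetsOfSize n (suc r))) + length (filter (_⊆? E) (subsetsOfSize n r))
      ≡⟨ cong₂ _+_ (count-⊆-subsetsOfSize n (suc r) E) (count-⊆-subsetsOfSize n r E) ⟩
    ∣ E ∣ C suc r + ∣ E ∣ C r
      ≡⟨ +-comm (∣ E ∣ C suc r) (∣ E ∣ C r) ⟩
    ∣ E ∣ C r + ∣ E ∣ C suc r
      ≡⟨ nCk+nC[k+1]≡[n+1]C[k+1] ∣ E ∣ r ⟩
    suc ∣ E ∣ C suc r ∎
    where
      open ≡-Reasoning
      outs = map (outside Vec.∷_) (subsetsOfSize n (suc r))
      ins = map (inside Vec.∷_) (subsetsOfSize n r)

  distinct⇔Unique : ∀ {n k} (v : Vec (Fin n) k) →
    (T (distinct v) → Unique (toList v)) × (Unique (toList v) → T (distinct v))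
  distinct⇔Unique Vec.[] = (λ _ → []) , (λ _ → _)
  distinct⇔Unique (x Vec.∷ v) = to , from
    where
      fresh⇔ : ∀ ys → (T (not (any (λ y → ⌊ x Fin.≟ y ⌋) ys)) → All (x ≢_) ys) ×
                      (All (x ≢_) ys → T (not (any (λ y → ⌊ x Fin.≟ y ⌋) ys)))
      fresh⇔ [] = (λ _ → []) , (λ _ → _)
      fresh⇔ (y ∷ ys) with x Fin.≟ y
      ... | yes x≡y = (λ ()) , (λ { (x≢y ∷ _) → x≢y x≡y })
      ... | no x≢y = (λ fresh → x≢y ∷ proj₁ (fresh⇔ ys) fresh) , (λ { (_ ∷ x∉) → proj₂ (fresh⇔ ys) x∉ })
      to : T (distinct (x Vec.∷ v)) → Unique (toList (x Vec.∷ v))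
      to d with T-∧ .Equivalence.to d
      ... | fresh , dv = proj₁ (fresh⇔ (toList v)) fresh ∷ proj₁ (distinct⇔Unique v) dv
      from : Unique (toList (x Vec.∷ v)) → T (distinct (x Vec.∷ v))
      from (x∉ ∷ u) = T-∧ .Equivalence.from (proj₂ (fresh⇔ (toList v)) x∉ , proj₂ (distinct⇔Unique v) u)

  face : ∀ {n k} → Vec (Fin n) (suc k) → Fin (suc k) → List (Fin n)
  face v j = tabulate (λ t → lookup v (punchIn j t))

  toList≡tabulate : ∀ {A : Set} {k} (v : Vec A k) → toList v ≡ tabulate (lookup v)
  toList≡tabulate Vec.[] = refl
  toList≡tabulate (x Vec.∷ v) = cong (x ∷_) (toList≡tabulate v)

  ∈-face : ∀ {n k} (v : Vec (Fin n) (suc k)) {i} j → i ≢ j → lookup v i ∈ face v j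
  ∈-face v {i} j i≢j = subst (λ i′ → lookup v i′ ∈ face v j) (Fin.punchIn-punchOut (i≢j ∘ sym))
                             (∈-tabulate⁺ (punchOut (i≢j ∘ sym)))

  face-⊑ : ∀ {n k} (v : Vec (Fin n) (suc k)) j → face v j ⊑ toList v
  face-⊑ (x Vec.∷ v) zero = x ∷ʳ ⊆-reflexive (sym (toList≡tabulate v))
  face-⊑ {k = suc k} (x Vec.∷ v) (suc j) = refl ∷ face-⊑ v j

  image≡setOf : ∀ {n k} (v : Vec (Fin n) k) → image v ≡ setOf (toList v)
  image≡setOf {k = k} v = sym (begin
    setOf (toList v) ≡⟨ cong setOf (toList≡tabulate v) ⟩
    setOf (tabulate (lookup v)) ≡⟨ cong setOf (List.map-tabulate (λ i → i) (lookup v)) ⟨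
    setOf (map (lookup v) (allFin k)) ≡⟨ List.foldr-map _ (lookup v) ∅ (allFin k) ⟩
    image v ∎)
    where open ≡-Reasoning

  imageExcept≡setOf : ∀ {n k} (v : Vec (Fin n) (suc k)) j → imageExcept v j ≡ setOf (face v j)
  imageExcept≡setOf {k = k} v j = ⊆-antisym to from
    where
      summand : Fin (suc k) → Subset _
      summand i = if ⌊ i Fin.≟ j ⌋ then ∅ else ⁅ lookup v i ⁆
      to : imageExcept v j ⊆ setOf (face v j)
      to x∈ with ∈-⋃⁻ summand (allFin (suc k)) x∈
      ... | i , _ , x∈summand with i Fin.≟ j
      ...   | yes _ = ⊥-elim (∉⊥ x∈summand)
      ...   | no i≢j rewrite x∈⁅y⁆⇒x≡y _ x∈summand = ∈-setOf⁺ (face v j) (∈-face v j i≢j)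
      from : setOf (face v j) ⊆ imageExcept v j
      from x∈ with ∈-tabulate⁻ (∈-setOf⁻ (face v j) x∈)
      ... | t , refl = ∈-⋃⁺ summand (allFin (suc k)) (∈-allFin (punchIn j t)) in-summand
        where
          in-summand : lookup v (punchIn j t) ∈ₛ summand (punchIn j t)
          in-summand with punchIn j t Fin.≟ j
          ... | yes eq = ⊥-elim (Fin.punchInᵢ≢i j t eq)
          ... | no _ = x∈⁅x⁆ _

  ∈-image⁻ : ∀ {n k} (v : Vec (Fin n) k) {x} → x ∈ₛ image v → ∃ λ i → x ≡ lookup v i
  ∈-image⁻ {k = k} v x∈ with ∈-⋃⁻ (λ i → ⁅ lookup v i ⁆) (allFin k) x∈
  ... | i , _ , x∈⁅vᵢ⁆ = i , x∈⁅y⁆⇒x≡y _ x∈⁅vᵢ⁆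

  ∈-imageExcept⁺ : ∀ {n k} (v : Vec (Fin n) (suc k)) {i} j → i ≢ j → lookup v i ∈ₛ imageExcept v j
  ∈-imageExcept⁺ v {i} j i≢j = subst (lookup v i ∈ₛ_) (sym (imageExcept≡setOf v j))
    (∈-setOf⁺ (face v j) (∈-face v j i≢j))

  ∣image∣≡ : ∀ {n k} (v : Vec (Fin n) k) → T (distinct v) → ∣ image v ∣ ≡ k
  ∣image∣≡ v d = trans (cong ∣_∣ (image≡setOf v))
    (trans (Unique⇒∣setOf∣≡length (proj₁ (distinct⇔Unique v) d)) (Vec.length-toList v))

  ∣imageExcept∣≤ : ∀ {n k} (v : Vec (Fin n) (suc k)) j → ∣ imageExcept v j ∣ ≤ k
  ∣imageExcept∣≤ v j = subst (λ S → ∣ S ∣ ≤ _) (sym (imageExcept≡setOf v j))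
    (≤-trans (∣setOf∣≤length (face v j)) (≤-reflexive (List.length-tabulate _)))

  -- Every k-element subset S of the image of k+1 distinct vertices is the
  -- face omitting one of them: some entry vⱼ lies outside S (by size), so
  -- S ⊆ imageExcept v j, and the sizes force equality.
  subset-is-face : ∀ {n k} (v : Vec (Fin n) (suc k)) → T (distinct v) → (S : Subset n) → ∣ S ∣ ≡ k →
    S ⊆ image v → ∃ λ j → S ≡ imageExcept v j
  subset-is-face {k = k} v d S |S| S⊆ = j , ⊆-antisym S⊆face face⊆S
    where
      some-entry-missing : ¬ (∀ i → lookup v i ∈ₛ S)
      some-entry-missing all-in = <⇒≱ (s≤s ≤-refl) (begin
        suc k ≡⟨ ∣image∣≡ v d ⟨
        ∣ image v ∣ ≤⟨ p⊆q⇒∣p∣≤∣q∣ image⊆S ⟩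
        ∣ S ∣ ≡⟨ |S| ⟩
        k ∎)
        where
          open ≤-Reasoning
          image⊆S : image v ⊆ S
          image⊆S x∈ with ∈-image⁻ v x∈
          ... | i , refl = all-in i
      missing = Fin.¬∀⟶∃¬ (suc k) (λ i → lookup v i ∈ₛ S) (λ i → lookup v i ∈? S) some-entry-missing
      j = proj₁ missing
      S⊆face : S ⊆ imageExcept v j
      S⊆face x∈ with ∈-image⁻ v (S⊆ x∈)
      ... | i , refl with i Fin.≟ j
      ...   | yes refl = ⊥-elim (proj₂ missing x∈)
      ...   | no i≢j = ∈-imageExcept⁺ v j i≢j
      face⊆S : imageExcept v j ⊆ S
      face⊆S {x} x∈ with x ∈? S
      ... | yes x∈S = x∈S
      ... | no x∉S = ⊥-elim (<⇒≱ (p⊂q⇒∣p∣<∣q∣ (S⊆face , x , x∈ , x∉S))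
                                  (≤-trans (∣imageExcept∣≤ v j) (≤-reflexive (sym |S|))))

module MonochromaticLayouts where

  open import Defs
  open import Data.Nat using (ℕ; zero; suc; _*_; _∸_)
  open import Data.Nat.Divisibility using (_∣_; _∣?_; m∣m*n)
  open import Data.Nat.Combinatorics using (_C_; nCk≡nC[n∸k]; nC1≡n)
  open import Data.Nat.Properties using (m+n∸n≡m; n≤1+n)
  open import Data.Bool using (Bool; not; _∧_; T)
  import Data.Bool as Bool
  open import Data.Bool.Properties using (T-∧; T?)
  open import Data.Fin using (Fin; zero; suc; toℕ)
  import Data.Fin as Fin
  open import Data.Fin.Subset using (Subset; _⊆_; ∣_∣)
  open import Data.Fin.Subset.Properties using (_⊆?_)
  open import Data.List using (List; []; _∷_; length; map; filter; allFin)
  import Data.List as List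
  import Data.List.Properties as List
  open import Data.List.Membership.Propositional using (_∈_)
  open import Data.List.Membership.Propositional.Properties using (∈-lookup; ∈-allFin; ∈-map⁺; ∈-concatMap⁺; ∈-filter⁺)
  open import Data.List.Relation.Unary.Any using (Any; here; index)
  import Data.List.Relation.Unary.Any as Any
  open import Data.List.Relation.Unary.Any.Properties using (lookup-index)
  open import Data.List.Relation.Unary.All using (All)
  import Data.List.Relation.Unary.All as All
  open import Data.List.Relation.Unary.All.Properties using (all⁺; all⁻; all-filter)
  open import Data.List.Relation.Unary.Unique.Propositional using (Unique)
  import Data.List.Membership.DecPropositional as DecMembership
  open import Data.Vec using (Vec; lookup; toList)
  import Data.Vec as Vec
  import Data.Vec.Properties as Vec
  open import Data.Product using (_,_; proj₁; proj₂)
  open import Function.Bundles using (Equivalence)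
  open import Relation.Nullary using (¬_; Dec; yes; no)
  open import Relation.Nullary.Decidable using (⌊_⌋; fromWitness; toWitness; dec-true; isYes≗does)
  open import Relation.Binary.PropositionalEquality
  open import Data.Empty using (⊥-elim)
  open ListCounting using (Unique⇒lookup-injective; length-filter-positions; sum-map-const)
  open Ramsey using (Monochromatic)
  open VertexSets

  _≟ₛ_ : ∀ {n} (S T : Subset n) → Dec (S ≡ T)
  _≟ₛ_ = Vec.≡-dec Bool._≟_

  open module ∈Subsets {n} = DecMembership (_≟ₛ_ {n}) using (_∈?_)

  ∈-tuples : ∀ {k n} (v : Vec (Fin n) k) → v ∈ tuples k n
  ∈-tuples Vec.[] = here refl
  ∈-tuples {n = n} (x Vec.∷ v) = ∈-concatMap⁺ (λ w → map (Vec._∷ w) (allFin n))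
    (Any.map (λ { refl → ∈-map⁺ (Vec._∷ v) (∈-allFin x) }) (∈-tuples v))

  module _ {k′ n : ℕ} (c : Colouring (suc k′) n) where

    private
      k = suc k′
      Ts = Tsets k n

    -- The colour f(T) of a (k-1)-set T (looked up at its position in the
    -- enumeration; sets that are not (k-1)-sets get colour 0).
    colourOf : Subset n → Fin k
    colourOf T with T ∈? Ts
    ... | yes T∈ = lookup c (index T∈)
    ... | no _ = zero

    colourOf-lookup : ∀ i → colourOf (List.lookup Ts i) ≡ lookup c i
    colourOf-lookup i with List.lookup Ts i ∈? Ts
    ... | yes T∈ = cong (lookup c) (Unique⇒lookup-injective (Unique-subsetsOfSize n k′) (sym (lookup-index T∈)))
    ... | no T∉ = ⊥-elim (T∉ (∈-lookup i))

    Λ : Fin k → Layout k n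
    Λ a _ T = ⌊ colourOf T Fin.≟ a ⌋

    -- In a clique of Λₐ, every (k-1)-set below its vertex set E is a face,
    -- hence of colour a; there are k C (k-1) = k of them, so the colour sum
    -- of E is k·a and E is not an edge.
    colourSum-clique : ∀ a (v : Vec (Fin n) k) → T (inK (Λ a) v) → colourSum c (image v) ≡ k * toℕ a
    colourSum-clique a v v∈K = trans (sum-map-const _ (toℕ a) below all-a) (cong (_* toℕ a) count)
      where
        d = proj₁ (T-∧ {distinct v} .Equivalence.to v∈K)
        faces-a = all⁺ (λ j → Λ a j (imageExcept v j)) (allFin k) (proj₂ (T-∧ {distinct v} .Equivalence.to v∈K))
        below = filter (λ i → List.lookup Ts i ⊆? image v) (allFin (m k n))
        colour-a : ∀ {i} → List.lookup Ts i ⊆ image v → toℕ (lookup c i) ≡ toℕ a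
        colour-a {i} T⊆ with subset-is-face v d (List.lookup Ts i) (All.lookup (size-subsetsOfSize n k′) (∈-lookup i)) T⊆
        ... | j , T≡face = cong toℕ (begin
          lookup c i ≡⟨ colourOf-lookup i ⟨
          colourOf (List.lookup Ts i) ≡⟨ cong colourOf T≡face ⟩
          colourOf (imageExcept v j) ≡⟨ toWitness (All.lookup faces-a (∈-allFin j)) ⟩
          a ∎)
          where open ≡-Reasoning
        all-a : All (λ i → toℕ (lookup c i) ≡ toℕ a) below
        all-a = All.map colour-a (all-filter _ (allFin (m k n)))
        count : length below ≡ k
        count = begin
          length below ≡⟨ length-filter-positions (_⊆? image v) Ts ⟩
          length (filter (_⊆? image v) Ts) ≡⟨ count-⊆-subsetsOfSize n k′ (image v) ⟩
          ∣ image v ∣ C k′ ≡⟨ cong (_C k′) (∣image∣≡ v d) ⟩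
          k C k′ ≡⟨ nCk≡nC[n∸k] (n≤1+n k′) ⟩
          k C (k ∸ k′) ≡⟨ cong (k C_) (m+n∸n≡m 1 k′) ⟩
          k C 1 ≡⟨ nC1≡n k ⟩
          k ∎
          where open ≡-Reasoning

    HKcount≡0 : ∀ a → HKcount c (Λ a) ≡ 0
    HKcount≡0 a = cong length (List.filter-none (λ v → T? (inK (Λ a) v ∧ isEdge c (image v))) {tuples k n} (All.tabulate (λ {v} _ → no-edge v)))
      where
        no-edge : ∀ v → ¬ T (inK (Λ a) v ∧ isEdge c (image v))
        no-edge v both with T-∧ .Equivalence.to both
        ... | v∈K , edge = subst (λ b → T (not b)) (trans (isYes≗does (k ∣? _)) (dec-true (k ∣? _) k∣sum)) edge
          where k∣sum = subst (k ∣_) (sym (colourSum-clique a v v∈K)) (m∣m*n (toℕ a))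

    cliques : Fin k → List (Vec (Fin n) k)
    cliques a = filter (λ v → T? (inK (Λ a) v)) (tuples k n)

    χ : List (Fin n) → Fin k
    χ s = colourOf (setOf s)

    -- A duplicate-free k-tuple whose (k-1)-element sublists all have
    -- χ-colour a is a clique of Λₐ: its faces are exactly those sublists.
    monochromatic⇒clique : ∀ a (u : Vec (Fin n) k) → Unique (toList u) →
      Monochromatic k′ χ a (toList u) → u ∈ cliques a
    monochromatic⇒clique a u u-unique mono = ∈-filter⁺ (λ v → T? (inK (Λ a) v)) (∈-tuples u)
      (T-∧ .Equivalence.from (proj₂ (distinct⇔Unique u) u-unique , all⁻ _ (All.tabulate face-a)))
      where
        face-a : ∀ {j} → j ∈ allFin k → T (Λ a j (imageExcept u j))
        face-a {j} _ = fromWitness (trans (cong colourOf (imageExcept≡setOf u j))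
                                          (mono (face u j) (face-⊑ u j) (List.length-tabulate _)))

module Supersaturation where

  open import Defs
  open import Data.Nat using (ℕ; zero; suc; _+_; _*_; _^_; _∸_; _≤_; _/_; _%_; NonZero; >-nonZero; z≤n; s≤s)
  open import Data.Nat.Properties
  open import Data.Nat.DivMod using (m≡m%n+[m/n]*n; m%n<n; m/n*n≤m; m≥n⇒m/n>0)
  open import Algebra.Properties.CommutativeSemigroup *-commutativeSemigroup using (interchange)
  open import Data.Fin using (Fin; zero; suc; combine; inject≤)
  import Data.Fin.Properties as Fin
  open import Data.List using (List; length; map; concatMap; allFin; replicate)
  import Data.List.Properties as List
  open import Data.List.Membership.Propositional using (_∈_)
  open import Data.List.Membership.Propositional.Properties using (∈-map⁺; ∈-map⁻; ∈-allFin; ∈-concatMap⁺)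
  import Data.List.Relation.Unary.Any as Any
  open import Data.List.Relation.Unary.Unique.Propositional using (Unique)
  import Data.List.Relation.Unary.Unique.Propositional.Properties as Unique
  open import Data.List.Relation.Binary.Sublist.Propositional using () renaming (_⊆_ to _⊑_)
  open import Data.List.Relation.Binary.Sublist.Propositional.Properties using (length-mono-≤)
  open import Data.Vec using (Vec; lookup; toList)
  import Data.Vec as Vec
  import Data.Vec.Properties as Vec
  open import Data.Product using (∃; _×_; _,_; proj₁; proj₂)
  open import Relation.Binary.PropositionalEquality
  open import Algebra.Properties.CommutativeMonoid.Sum +-0-commutativeMonoid using (sum; sum-cong-≗)
  open ListCounting
  open Ramsey using (ramsey; IsRamseyNumber; Monochromatic)
  open VertexSets using (toList≡tabulate)
  open MonochromaticLayouts

  n≤2*[R*[n/R]] : ∀ n R .{{_ : NonZero R}} → R ≤ n → n ≤ 2 * (R * (n / R))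
  n≤2*[R*[n/R]] n R R≤n = begin
    n ≡⟨ m≡m%n+[m/n]*n n R ⟩
    n % R + n / R * R ≤⟨ +-monoˡ-≤ (n / R * R) (≤-trans (<⇒≤ (m%n<n n R)) (≤-reflexive (sym (*-identityˡ R)))) ⟩
    1 * R + n / R * R ≤⟨ +-monoˡ-≤ (n / R * R) (*-monoˡ-≤ R (m≥n⇒m/n>0 R≤n)) ⟩
    n / R * R + n / R * R ≡⟨ double R (n / R) ⟩
    2 * (R * (n / R)) ∎
    where
      open ≤-Reasoning
      double : ∀ x y → y * x + y * x ≡ 2 * (x * y)
      double x y = trans (cong (λ z → z + z) (*-comm y x)) (cong (x * y +_) (sym (+-identityʳ (x * y))))

  ^-distribʳ-* : ∀ a b n → (a * b) ^ n ≡ a ^ n * b ^ n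
  ^-distribʳ-* a b zero = refl
  ^-distribʳ-* a b (suc n) = trans (cong (a * b *_) (^-distribʳ-* a b n)) (interchange a b (a ^ n) (b ^ n))

  module _ (k′ : ℕ) where

    private
      k = suc k′

    -- R guarantees, in any R vertices, k of them whose (k-1)-subsets all
    -- have the same colour.
    R : ℕ
    R = proj₁ (ramsey k′ k′ k)

    R-ramsey : IsRamseyNumber k′ k k R
    R-ramsey = proj₂ (ramsey k′ k′ k)

    -- R ≥ k, since R vertices contain k of them.
    k≤R : k ≤ R
    k≤R with R-ramsey (replicate R 0) (≤-reflexive (sym (List.length-replicate R))) (λ _ → zero)
    ... | X , X⊑ , |X| , _ =
      ≤-trans (≤-reflexive (sym |X|)) (≤-trans (length-mono-≤ X⊑) (≤-reflexive (List.length-replicate R)))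

    instance
      R≢0 : NonZero R
      R≢0 = >-nonZero (≤-trans (s≤s z≤n) k≤R)

    -- Split the vertex set into R blocks of B = ⌊n/R⌋ vertices.  A
    -- transversal picks one vertex from each block; there are B^R of them,
    -- each consisting of R distinct vertices, and each contains a clique of
    -- some Λₐ by Ramsey's theorem.  The encoding bound then yields
    -- B^R ≤ 2^R · (Σₐ |K_k(Λₐ)|) · n^(R-k).
    module _ (n : ℕ) (c : Colouring k n) where

      private
        B = n / R
        R*B≤n : R * B ≤ n
        R*B≤n = ≤-trans (≤-reflexive (*-comm R B)) (m/n*n≤m n R)

      cell : Fin R → Fin B → Fin n
      cell i t = inject≤ (combine i t) R*B≤n

      cell-injective : ∀ {i j t s} → cell i t ≡ cell j s → i ≡ j × t ≡ s
      cell-injective {i} {j} {t} {s} e =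
        Fin.combine-injective i t j s (Fin.inject≤-injective R*B≤n R*B≤n _ _ e)

      transversal : Vec (Fin B) R → Vec (Fin n) R
      transversal t = Vec.tabulate (λ i → cell i (lookup t i))

      lookup-transversal : ∀ t i → lookup (transversal t) i ≡ cell i (lookup t i)
      lookup-transversal t i = Vec.lookup∘tabulate _ i

      transversal-injective : ∀ {t s} → toList (transversal t) ≡ toList (transversal s) → t ≡ s
      transversal-injective {t} {s} e =
        trans (sym (Vec.tabulate∘lookup t)) (trans (Vec.tabulate-cong same) (Vec.tabulate∘lookup s))
        where
          same-vec : transversal t ≡ transversal s
          same-vec = trans (sym (Vec.cast-is-id refl (transversal t))) (Vec.toList-injective refl _ _ e)
          same : ∀ i → lookup t i ≡ lookup s i
          same i = proj₂ (cell-injective (trans (sym (lookup-transversal t i))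
            (trans (cong (λ v → lookup v i) same-vec) (lookup-transversal s i))))

      Unique-transversal : ∀ t → Unique (toList (transversal t))
      Unique-transversal t =
        subst Unique (sym (toList≡tabulate (transversal t))) (Unique.tabulate⁺ distinct-cells)
        where
          distinct-cells : ∀ {i j} → lookup (transversal t) i ≡ lookup (transversal t) j → i ≡ j
          distinct-cells {i} {j} e =
            proj₁ (cell-injective (trans (sym (lookup-transversal t i)) (trans e (lookup-transversal t j))))

      transversals : List (List (Fin n))
      transversals = map (λ t → toList (transversal t)) (allVecs (allFin B) R)

      K : Fin k → ℕ
      K a = Kcount (Λ {n = n} c a)

      allCliques : List (List (Fin n))
      allCliques = concatMap (λ a → map toList (cliques {n = n} c a)) (allFin k)

      monochromatic⇒∈allCliques : ∀ {w X} a → Unique w → X ⊑ w → length X ≡ k →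
        Monochromatic k′ (χ {n = n} c) a X → X ∈ allCliques
      monochromatic⇒∈allCliques {X = X} a w-unique X⊑w |X| mono =
        ∈-concatMap⁺ (λ a → map toList (cliques {n = n} c a)) (Any.map (λ { refl → X∈ }) (∈-allFin a))
        where
          u = Vec.cast |X| (Vec.fromList X)
          toList-u : toList u ≡ X
          toList-u = trans (Vec.toList-cast |X| _) (Vec.toList∘fromList X)
          X∈ : X ∈ map toList (cliques {n = n} c a)
          X∈ = subst (_∈ _) toList-u (∈-map⁺ toList (monochromatic⇒clique c a u
                 (subst Unique (sym toList-u) (Unique-⊑ X⊑w w-unique))
                 (subst (Monochromatic k′ (χ {n = n} c) a) (sym toList-u) mono)))

      transversal-contains-clique : ∀ {w} → w ∈ transversals →
        length w ≡ R × ∃ λ X → X ⊑ w × length X ≡ k × X ∈ allCliques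
      transversal-contains-clique w∈ with ∈-map⁻ _ w∈
      ... | t , _ , refl = |w| , clique (R-ramsey w (≤-reflexive (sym |w|)) (χ {n = n} c))
        where
          w = toList (transversal t)
          |w| = Vec.length-toList (transversal t)
          clique : (∃ λ X → X ⊑ w × length X ≡ k × ∃ λ a → Monochromatic k′ (χ {n = n} c) a X) →
            ∃ λ X → X ⊑ w × length X ≡ k × X ∈ allCliques
          clique (X , X⊑w , |X| , a , mono) =
            X , X⊑w , |X| , monochromatic⇒∈allCliques a (Unique-transversal t) X⊑w |X| mono

      supersaturation-count : B ^ R ≤ 2 ^ R * (sum K * n ^ (R ∸ k))
      supersaturation-count = begin
        B ^ R
          ≡⟨ cong (_^ R) (List.length-tabulate (λ i → i)) ⟨
        length (allFin B) ^ R
          ≡⟨ trans (List.length-map _ (allVecs (allFin B) R)) (length-allVecs (allFin B) R) ⟨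
        length transversals
          ≤⟨ encoding-bound (allFin n) ∈-allFin R k allCliques transversals
                            Unique-transversals transversal-contains-clique ⟩
        2 ^ R * (length allCliques * length (allFin n) ^ (R ∸ k))
          ≡⟨ cong (λ x → 2 ^ R * (x * length (allFin n) ^ (R ∸ k))) count-cliques ⟩
        2 ^ R * (sum K * length (allFin n) ^ (R ∸ k))
          ≡⟨ cong (λ x → 2 ^ R * (sum K * x ^ (R ∸ k))) (List.length-tabulate (λ i → i)) ⟩
        2 ^ R * (sum K * n ^ (R ∸ k)) ∎
        where
          open ≤-Reasoning
          Unique-transversals : Unique transversals
          Unique-transversals = Unique.map⁺ transversal-injective (Unique-allVecs (Unique.allFin⁺ B) R)
          count-cliques : length allCliques ≡ sum K
          count-cliques = trans (length-concatMap-tabulate (λ a → map toList (cliques {n = n} c a)) (λ a → a))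
                                (sum-cong-≗ {k} (λ a → List.length-map toList (cliques {n = n} c a)))

    D : ℕ
    D = (2 * R) ^ R * 2 ^ R * k

    instance
      D≢0 : NonZero D
      D≢0 = m*n≢0 ((2 * R) ^ R * 2 ^ R) k
        {{m*n≢0 ((2 * R) ^ R) (2 ^ R) {{m^n≢0 (2 * R) R {{m*n≢0 2 R}}}} {{m^n≢0 2 R}}}}

    -- Supersaturation: once n ≥ R, some colour a has |K_k(Λₐ)| ≥ n^k / D.
    -- Combine the count above with n ≤ 2RB and pick the largest colour class.
    supersaturation : ∀ n → R ≤ n → (c : Colouring k n) → ∃ λ a → n ^ k ≤ D * Kcount (Λ {n = n} c a)
    supersaturation n R≤n c = a , *-cancelʳ-≤ (n ^ k) (D * K n c a) (n ^ (R ∸ k)) {{n^[R∸k]≢0}} bound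
      where
        largest = sum≤size*max k′ (K n c)
        a = proj₁ largest
        P = n ^ (R ∸ k)
        n^[R∸k]≢0 : NonZero P
        n^[R∸k]≢0 = m^n≢0 n (R ∸ k) {{>-nonZero (≤-trans (s≤s z≤n) (≤-trans k≤R R≤n))}}
        rearrange : ∀ x y z w v → x * (y * (z * w * v)) ≡ x * y * z * w * v
        rearrange x y z w v = trans (sym (*-assoc x y (z * w * v)))
          (trans (sym (*-assoc (x * y) (z * w) v)) (cong (_* v) (sym (*-assoc (x * y) z w))))
        bound : n ^ k * P ≤ D * K n c a * P
        bound = begin
          n ^ k * P ≡⟨ ^-distribˡ-+-* n k (R ∸ k) ⟨
          n ^ (k + (R ∸ k)) ≡⟨ cong (n ^_) (m+[n∸m]≡n k≤R) ⟩
          n ^ R ≤⟨ ^-monoˡ-≤ R (n≤2*[R*[n/R]] n R R≤n) ⟩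
          (2 * (R * (n / R))) ^ R ≡⟨ cong (_^ R) (*-assoc 2 R (n / R)) ⟨
          (2 * R * (n / R)) ^ R ≡⟨ ^-distribʳ-* (2 * R) (n / R) R ⟩
          (2 * R) ^ R * (n / R) ^ R ≤⟨ *-monoʳ-≤ ((2 * R) ^ R) (supersaturation-count n c) ⟩
          (2 * R) ^ R * (2 ^ R * (sum (K n c) * P))
            ≤⟨ *-monoʳ-≤ ((2 * R) ^ R) (*-monoʳ-≤ (2 ^ R) (*-monoˡ-≤ P (proj₂ largest))) ⟩
          (2 * R) ^ R * (2 ^ R * (k * K n c a * P)) ≡⟨ rearrange ((2 * R) ^ R) (2 ^ R) k (K n c a) P ⟩
          D * K n c a * P ∎
          where open ≤-Reasoning

module DiscrepancyGap where

  open import Defs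
  open import Data.Nat using (ℕ; suc; _≤_; s≤s)
  import Data.Nat as ℕ
  import Data.Nat.Properties as ℕ
  open import Data.Nat.Coprimality using (1-coprimeTo)
  import Data.Nat.Coprimality as Coprime
  open import Data.Integer using (+_; +≤+)
  import Data.Integer as ℤ
  import Data.Integer.Properties as ℤ
  open import Data.Rational using (ℚ; mkℚ; 0ℚ; 1ℚ; _<_; _*_; _-_; _+_; -_; 1/_; _/_)
    renaming (_≤_ to _≤ℚ_)
  open import Data.Rational using (Positive; NonNegative; NonZero; *≤*; positive; nonNegative)
  open import Data.Rational.Properties
  open import Relation.Binary.PropositionalEquality using (_≡_; cong; sym; trans; subst; subst₂)

  ℕ→ℚ≡mkℚ : ∀ a → ℕ→ℚ a ≡ mkℚ (+ a) 0 (Coprime.sym (1-coprimeTo a))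
  ℕ→ℚ≡mkℚ a = normalize-coprime (Coprime.sym (1-coprimeTo a))

  ℕ→ℚ-* : ∀ a b → ℕ→ℚ (a ℕ.* b) ≡ ℕ→ℚ a * ℕ→ℚ b
  ℕ→ℚ-* a b rewrite ℕ→ℚ≡mkℚ a | ℕ→ℚ≡mkℚ b = cong (_/ 1) (ℤ.pos-* a b)

  ℕ→ℚ-mono : ∀ {a b} → a ≤ b → ℕ→ℚ a ≤ℚ ℕ→ℚ b
  ℕ→ℚ-mono {a} {b} a≤b rewrite ℕ→ℚ≡mkℚ a | ℕ→ℚ≡mkℚ b =
    *≤* (subst₂ ℤ._≤_ (sym (ℤ.*-identityʳ (+ a))) (sym (ℤ.*-identityʳ (+ b))) (+≤+ a≤b))

  ℕ→ℚ-pos : ∀ a → .{{ℕ.NonZero a}} → Positive (ℕ→ℚ a)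
  ℕ→ℚ-pos (suc a) = normalize-pos (suc a) 1

  pOf-pos : ∀ k → 2 ≤ k → Positive (pOf k)
  pOf-pos (suc (suc j)) (s≤s (s≤s _)) = normalize-pos (suc j) (suc (suc j))

  1-ε-shrinks : ∀ (ε X : ℚ) → 0ℚ < ε → 0ℚ ≤ℚ X → (1ℚ - ε) * X ≤ℚ X
  1-ε-shrinks ε X ε>0 X≥0 =
    subst ((1ℚ - ε) * X ≤ℚ_) (*-identityˡ X) (*-monoʳ-≤-nonNeg X {{nonNegative X≥0}} 1-ε≤1)
    where
      1-ε≤1 : 1ℚ - ε ≤ℚ 1ℚ
      1-ε≤1 = subst (1ℚ - ε ≤ℚ_) (+-identityʳ 1ℚ) (+-monoʳ-≤ 1ℚ (neg-antimono-≤ (<⇒≤ ε>0)))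

  gap : ∀ (p μ D A M : ℚ) .{{_ : Positive p}} .{{_ : Positive D}} .{{_ : Positive A}} →
    0ℚ < μ → μ < p * (1/ D) {{pos⇒nonZero D}} → M ≤ℚ D * A → 0ℚ < p * A - μ * M
  gap p μ D A M μ>0 μ<p/D M≤DA = subst (_< p * A - μ * M) (+-inverseʳ (μ * M)) (+-monoˡ-< (- (μ * M)) μM<pA)
    where
      instance
        μ-pos : Positive μ
        μ-pos = positive μ>0
        μ-nonNeg : NonNegative μ
        μ-nonNeg = pos⇒nonNeg μ
        D≢0 : NonZero D
        D≢0 = pos⇒nonZero D
      p/D*D≡p : p * (1/ D) * D ≡ p
      p/D*D≡p = trans (*-assoc p (1/ D) D) (trans (cong (p *_) (*-inverseˡ D)) (*-identityʳ p))
      μM<pA : μ * M < p * A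
      μM<pA = ≤-<-trans (*-monoˡ-≤-nonNeg μ M≤DA)
        (subst (_< p * A) (*-assoc μ D A)
          (subst (λ z → μ * D * A < z * A) p/D*D≡p (*-monoˡ-<-pos A (*-monoˡ-<-pos D μ<p/D))))

  discrepancy-gap : ∀ (p μ : ℚ) (D K M : ℕ) .{{_ : Positive p}} .{{_ : ℕ.NonZero D}} .{{_ : ℕ.NonZero M}} →
    0ℚ < μ → μ < p * (1/ ℕ→ℚ D) {{pos⇒nonZero (ℕ→ℚ D) {{ℕ→ℚ-pos D}}}} → M ≤ D ℕ.* K → 0ℚ < p * ℕ→ℚ K - μ * ℕ→ℚ M
  discrepancy-gap p μ D K M μ>0 μ<p/D M≤DK =
    gap p μ (ℕ→ℚ D) (ℕ→ℚ K) (ℕ→ℚ M) μ>0 μ<p/D (subst (ℕ→ℚ M ≤ℚ_) (ℕ→ℚ-* D K) (ℕ→ℚ-mono M≤DK))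
    where
      K≢0 : ℕ.NonZero K
      K≢0 = ℕ.m*n≢0⇒n≢0 D {{ℕ.>-nonZero (ℕ.≤-trans (ℕ.>-nonZero⁻¹ M) M≤DK)}}
      instance
        D-pos : Positive (ℕ→ℚ D)
        D-pos = ℕ→ℚ-pos D
        K-pos : Positive (ℕ→ℚ K)
        K-pos = ℕ→ℚ-pos K {{K≢0}}

open import Defs
open import Data.Nat using (ℕ; _≤_; _^_)
open import Data.Rational using (ℚ; 0ℚ; 1ℚ; _<_; _*_; _-_) renaming (_≤_ to _≤ℚ_)
open import Data.List using (List; length)
open import Data.List.Relation.Unary.All using (All)
open import Data.List.Relation.Unary.Unique.Propositional using (Unique)
open import Data.Product using (Σ; ∃; _×_)

open import Data.Nat using (suc; s≤s; z≤n; NonZero; >-nonZero) renaming (_*_ to _*ℕ_)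
import Data.Nat.Properties as ℕ
open import Data.List using (allFin)
import Data.List.Properties as List
import Data.List.Relation.Unary.All as All
import Data.List.Relation.Unary.Unique.Propositional.Properties as Unique
open import Data.Product using (_,_)
open import Data.Rational using (1/_; Positive)
open import Data.Rational.Properties using (pos⇒nonZero; pos*pos⇒pos; 1/pos⇒pos; positive⁻¹)
open import Relation.Binary.PropositionalEquality using (_≡_; sym; trans; cong; subst)
open ListCounting using (allVecs; length-allVecs; Unique-allVecs)
open MonochromaticLayouts using (Λ; HKcount≡0)
open Supersaturation using (R; D; D≢0; k≤R; supersaturation)
open DiscrepancyGap using (ℕ→ℚ-pos; ℕ→ℚ-mono; pOf-pos; 1-ε-shrinks; discrepancy-gap)

module _ (j : ℕ) where

  private
    k′ = suc j
    k = suc k′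
    p = pOf k
    instance
      p-pos : Positive p
      p-pos = pOf-pos k (s≤s (s≤s z≤n))
      D-pos : Positive (ℕ→ℚ (D k′))
      D-pos = ℕ→ℚ-pos (D k′) {{D≢0 k′}}

  μ₀ : ℚ
  μ₀ = p * (1/ ℕ→ℚ (D k′)) {{pos⇒nonZero (ℕ→ℚ (D k′))}}

  μ₀>0 : 0ℚ < μ₀
  μ₀>0 = positive⁻¹ μ₀ {{pos*pos⇒pos p _ {{1/pos⇒pos (ℕ→ℚ (D k′))}}}}

  -- Every colouring fails Disc once n ≥ R: the layout Λₐ provided by
  -- supersaturation has no edges but at least n^k / D cliques.
  every-colouring-fails : ∀ μ → 0ℚ < μ → μ < μ₀ → ∀ n → R k′ ≤ n → (c : Colouring k n) →
    FailsDisc k n p μ c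
  every-colouring-fails μ μ>0 μ<μ₀ n R≤n c = fails (supersaturation k′ n R≤n c)
    where
      instance
        D≢0′ : NonZero (D k′)
        D≢0′ = D≢0 k′
        n^k≢0 : NonZero (n ^ k)
        n^k≢0 = ℕ.m^n≢0 n k {{>-nonZero (ℕ.≤-trans (s≤s z≤n) (ℕ.≤-trans (k≤R k′) R≤n))}}
      fails : (∃ λ a → n ^ k ≤ D k′ *ℕ Kcount (Λ {n = n} c a)) → FailsDisc k n p μ c
      fails (a , n^k≤DK) = Λ {n = n} c a ,
        subst (λ h → ℕ→ℚ h < p * ℕ→ℚ (Kcount (Λ {n = n} c a)) - μ * ℕ→ℚ (n ^ k))
              (sym (HKcount≡0 {n = n} c a))
              (discrepancy-gap p μ (D k′) (Kcount (Λ {n = n} c a)) (n ^ k) μ>0 μ<μ₀ n^k≤DK)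

  -- The list of all k^m colourings, each once: it trivially contains a
  -- (1 - ε)-fraction of them.
  colourings : ∀ n → List (Colouring k n)
  colourings n = allVecs (allFin k) (m k n)

  Unique-colourings : ∀ n → Unique (colourings n)
  Unique-colourings n = Unique-allVecs (Unique.allFin⁺ k) (m k n)

  almost-all-colourings : ∀ ε → 0ℚ < ε → ∀ n → (1ℚ - ε) * ℕ→ℚ (k ^ m k n) ≤ℚ ℕ→ℚ (length (colourings n))
  almost-all-colourings ε ε>0 n = subst (λ x → (1ℚ - ε) * ℕ→ℚ (k ^ m k n) ≤ℚ ℕ→ℚ x) (sym length-colourings)
    (1-ε-shrinks ε (ℕ→ℚ (k ^ m k n)) ε>0 (ℕ→ℚ-mono {0} {k ^ m k n} z≤n))
    where
      length-colourings : length (colourings n) ≡ k ^ m k n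
      length-colourings = trans (length-allVecs (allFin k) (m k n)) (cong (_^ m k n) (List.length-tabulate (λ i → i)))

lemma20 : (k : ℕ) → 2 ≤ k →
    ∃ λ (μ₀ : ℚ) → 0ℚ < μ₀ ×
    ((μ : ℚ) → 0ℚ < μ → μ < μ₀ →
    (ε : ℚ) → 0ℚ < ε →
    ∃ λ (N : ℕ) → (n : ℕ) → N ≤ n →
    ∃ λ (good : List (Colouring k n)) →
    Unique good ×
    All (FailsDisc k n (pOf k) μ) good ×
    (1ℚ - ε) * ℕ→ℚ (k ^ m k n) ≤ℚ ℕ→ℚ (length good))
lemma20 (suc (suc j)) (s≤s (s≤s _)) = μ₀ j , μ₀>0 j , λ μ μ>0 μ<μ₀ ε ε>0 → R (suc j) , λ n R≤n →
  colourings j n ,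
  Unique-colourings j n ,
  All.tabulate (λ {c} _ → every-colouring-fails j μ μ>0 μ<μ₀ n R≤n c) ,
  almost-all-colourings j ε ε>0 n
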